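{- There exists a family $(D^n)_{n\in\mathbb{N}_{>0}}$ of $n\times n$ distance matrices such that each $D^n$ is $\mathrm{Fo}$-realizable, and every temporal graph $\mathcal{G}$ with $\mathrm{Fo}(\mathcal{G})=D^n$ has $\Omega(n^2)$ time labels in total.
   Context: A temporal graph $\mathcal{G}=(G,\lambda)$ consists of a static undirected graph $G=(V,E)$ with $V=[n]$ and a labeling $\lambda:E\to 2^{\mathbb{N}_{>0}}$ assigning to each edge the (finite) set of positive times at which it appears; its number of time labels is $\sum_{e\in E}|\lambda(e)|$. A strict temporal $uv$-path is a path $u=v_0,\dots,v_k=v$ in $G$ with distinct vertices and times $\tau_1<\dots<\tau_k$, $\tau_i\in\lambda(\{v_{i-1},v_i\})$; its arrival time is $\tau_k$. $\mathrm{Fo}(\mathcal{G})$ is the $n\times n$ matrix with diagonal $0$ and off-diagonal entry $(u,v)$ equal to the minimum arrival time of a strict temporal $uv$-path ($\infty$ if none). A distance matrix is an $n\times n$ matrix with entries in $\mathbb{N}\cup\{\infty\}$ that is $0$ exactly on the diagonal; it is $\mathrm{Fo}$-realizable if $D=\mathrm{Fo}(\mathcal{G})$ for some temporal graph $\mathcal{G}$ on $[n]$. -}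

module Defs where

open import Data.Nat using (ℕ; zero; suc; _+_; _*_; _≤_; _<_)
open import Data.Fin using (Fin; toℕ)
open import Data.List using (List; []; _∷_; _∷ʳ_; map; length; allFin)
open import Data.Nat.ListAction using (sum)
open import Data.List.Membership.Propositional using (_∈_)
open import Data.List.Relation.Unary.Unique.Propositional using (Unique)
open import Data.Product using (Σ; _×_; _,_; proj₁; ∃)
open import Data.Unit using (⊤)
open import Relation.Nullary using (¬_)
open import Relation.Binary.PropositionalEquality using (_≡_; _≢_)

data ℕ∞ : Set where
  fin : ℕ → ℕ∞
  ∞   : ℕ∞

Matrix : ℕ → Set
Matrix n = Fin n → Fin n → ℕ∞

IsDistanceMatrix : {n : ℕ} → Matrix n → Set
IsDistanceMatrix {n} D = (u v : Fin n) → (D u v ≡ fin 0 → u ≡ v) × (u ≡ v → D u v ≡ fin 0)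

-- A temporal graph on vertex set Fin n.  labels u v is the (finite) set λ({u,v}) of
-- positive time labels of the edge {u,v}, given as a duplicate-free list; it is
-- symmetric and empty on loops.  The static edge set is (implicitly) the set of
-- pairs carrying at least one label (edges with empty label set have no effect
-- on Fo or on the number of time labels).
record TemporalGraph (n : ℕ) : Set where
  field
    labels   : Fin n → Fin n → List ℕ
    symm     : (u v : Fin n) → labels u v ≡ labels v u
    noLoop   : (u : Fin n) → labels u u ≡ []
    positive : (u v : Fin n) (t : ℕ) → t ∈ labels u v → 0 < t
    setLike  : (u v : Fin n) → Unique (labels u v)

open TemporalGraph public

numLabels : {n : ℕ} → TemporalGraph n → ℕ
numLabels {n} G = sum (map (λ u → sum (map (λ v → rowEntry u v) (allFin n))) (allFin n))
  where
    rowEntry : Fin n → Fin n → ℕ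
    rowEntry u v with Data.Nat._<?_ (toℕ u) (toℕ v)
    ... | Relation.Nullary.yes _ = length (labels G u v)
    ... | Relation.Nullary.no  _ = 0

TimeRespecting : {n : ℕ} → TemporalGraph n → Fin n → ℕ → List (Fin n × ℕ) → Set
TimeRespecting G cur t [] = ⊤
TimeRespecting G cur t ((w , τ) ∷ rest) = (t < τ) × (τ ∈ labels G cur w) × TimeRespecting G w τ rest

-- a strict temporal uv-path with arrival time t: u = v_0, v_1, …, v_k = v (k ≥ 1),
-- distinct vertices, times τ_1 < … < τ_k = t (all positive, so starting bound 0)
StrictTemporalPath : {n : ℕ} → TemporalGraph n → Fin n → Fin n → ℕ → Set
StrictTemporalPath {n} G u v t =
  Σ (List (Fin n × ℕ)) λ pre →
    TimeRespecting G u 0 (pre ∷ʳ (v , t)) × Unique (u ∷ map proj₁ (pre ∷ʳ (v , t)))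

IsFoEntry : {n : ℕ} → TemporalGraph n → Fin n → Fin n → ℕ∞ → Set
IsFoEntry G u v (fin t) =
  (u ≡ v × t ≡ 0) Data.Sum.⊎
  (u ≢ v × StrictTemporalPath G u v t × ((t' : ℕ) → StrictTemporalPath G u v t' → t ≤ t'))
  where import Data.Sum
IsFoEntry G u v ∞ = u ≢ v × ((t : ℕ) → ¬ StrictTemporalPath G u v t)

FoEq : {n : ℕ} → TemporalGraph n → Matrix n → Set
FoEq {n} G D = (u v : Fin n) → IsFoEntry G u v (D u v)

FoRealizable : {n : ℕ} → Matrix n → Set
FoRealizable {n} D = Σ (TemporalGraph n) λ G → FoEq G D

-- Let D be the matrix with every off-diagonal entry 1. The complete graph with every edge
-- labelled 1 realizes it. Conversely, a strict temporal path arriving at time 1 consists of a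
-- single edge at time 1 (times are positive and strictly increasing), so in any realization
-- of D every pair of distinct vertices spans an edge carrying label 1. Hence any realization
-- has at least n choose 2 time labels, and n² ≤ 4 · (n choose 2) once n ≥ 2.
{-# OPTIONS --safe #-}
module Submission where

open import Defs
open import Data.Bool using (if_then_else_)
open import Data.Empty using (⊥-elim)
open import Data.Fin using (Fin; zero; suc; toℕ; _≟_) renaming (_<_ to _<ᶠ_)
open import Data.Fin.Properties using (<⇒≢)
open import Data.List using (List; []; _∷_; _∷ʳ_; map; length; allFin; tabulate)
open import Data.List.Membership.Propositional using (_∈_)
open import Data.List.Membership.Propositional.Properties using (∈-length)
open import Data.List.Properties using (map-tabulate; tabulate-cong)
open import Data.List.Relation.Unary.All using ([]; _∷_)
open import Data.List.Relation.Unary.AllPairs using ([]; _∷_)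
open import Data.List.Relation.Unary.Any using (here)
open import Data.List.Relation.Unary.Unique.Propositional using (Unique)
open import Data.Nat using (ℕ; suc; _+_; _*_; _≤_; _<_; _<?_; z≤n; s≤s)
open import Data.Nat.Combinatorics using (_C_; nC1≡n; nCk+nC[k+1]≡[n+1]C[k+1])
open import Data.Nat.ListAction using (sum)
open import Data.Nat.Properties
  using (≤-refl; ≤-trans; <-trans; ≤⇒≯; m≤n+m; +-comm; +-mono-≤; +-monoˡ-≤; *-monoʳ-≤;
         *-distribˡ-+; module ≤-Reasoning)
open import Data.Nat.Tactic.RingSolver using (solve-∀)
open import Data.Product using (Σ; _×_; ∃; _,_; proj₁; proj₂)
open import Data.Sum using (inj₁; inj₂)
open import Data.Unit using (tt)
open import Function using (id)
open import Relation.Nullary using (does; yes; no)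
open import Relation.Binary.PropositionalEquality
  using (_≡_; _≢_; refl; sym; trans; cong; subst; module ≡-Reasoning)

private
  variable
    A : Set
    n t : ℕ
    u v : Fin n
    G : TemporalGraph n

offDiagonal : A → A → Fin n → Fin n → A
offDiagonal d o u v = if does (u ≟ v) then d else o

offDiagonal-≡ : {d o : A} → u ≡ v → offDiagonal d o u v ≡ d
offDiagonal-≡ {u = u} {v} u≡v with u ≟ v
... | yes _ = refl
... | no u≢v = ⊥-elim (u≢v u≡v)

offDiagonal-≢ : {d o : A} → u ≢ v → offDiagonal d o u v ≡ o
offDiagonal-≢ {u = u} {v} u≢v with u ≟ v
... | yes u≡v = ⊥-elim (u≢v u≡v)
... | no _ = refl

offDiagonal-sym : {d o : A} (u v : Fin n) → offDiagonal d o u v ≡ offDiagonal d o v u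
offDiagonal-sym u v with u ≟ v
... | yes u≡v = sym (offDiagonal-≡ (sym u≡v))
... | no u≢v = sym (offDiagonal-≢ (λ v≡u → u≢v (sym v≡u)))

offDiagonal-elim : (P : A → Set) {d o : A} → P d → P o → (u v : Fin n) → P (offDiagonal d o u v)
offDiagonal-elim P pd po u v with u ≟ v
... | yes _ = pd
... | no _ = po

allOnes : (n : ℕ) → Matrix n
allOnes n = offDiagonal (fin 0) (fin 1)

allOnes-isDistanceMatrix : IsDistanceMatrix (allOnes n)
allOnes-isDistanceMatrix u v = diagonal-only , offDiagonal-≡
  where
  diagonal-only : allOnes _ u v ≡ fin 0 → u ≡ v
  diagonal-only _ with u ≟ v
  diagonal-only _ | yes u≡v = u≡v
  diagonal-only () | no _

completeAtOne : (n : ℕ) → TemporalGraph n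
completeAtOne n = record
  { labels = offDiagonal [] (1 ∷ [])
  ; symm = offDiagonal-sym
  ; noLoop = λ u → offDiagonal-≡ {u = u} refl
  ; positive = λ u v → offDiagonal-elim (λ ts → ∀ t → t ∈ ts → 0 < t)
                         (λ _ ()) (λ { _ (here refl) → s≤s z≤n }) u v
  ; setLike = offDiagonal-elim Unique [] ([] ∷ [])
  }

arrival-after-start : (G : TemporalGraph n) (cur : Fin n) (t : ℕ) (steps : List (Fin n × ℕ))
  {v : Fin n} {t′ : ℕ} → TimeRespecting G cur t (steps ∷ʳ (v , t′)) → t < t′
arrival-after-start G cur t [] (t<t′ , _) = t<t′
arrival-after-start G cur t ((w , τ) ∷ steps) (t<τ , _ , rest) =
  <-trans t<τ (arrival-after-start G w τ steps rest)

arrival-positive : StrictTemporalPath G u v t → 0 < t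
arrival-positive {G = G} {u} (steps , respecting , _) = arrival-after-start G u 0 steps respecting

arrival≡1⇒1∈labels : StrictTemporalPath G u v 1 → 1 ∈ labels G u v
arrival≡1⇒1∈labels ([] , (_ , 1∈uv , _) , _) = 1∈uv
arrival≡1⇒1∈labels {G = G} ((w , τ) ∷ steps , (0<τ , _ , rest) , _) =
  ⊥-elim (≤⇒≯ 0<τ (arrival-after-start G w τ steps rest))

edge-path : u ≢ v → 0 < t → t ∈ labels G u v → StrictTemporalPath G u v t
edge-path u≢v 0<t t∈uv = [] , (0<t , t∈uv , tt) , ((u≢v ∷ []) ∷ ([] ∷ []))

completeAtOne-realizes-allOnes : FoEq (completeAtOne n) (allOnes n)
completeAtOne-realizes-allOnes u v with u ≟ v
... | yes u≡v = inj₁ (u≡v , refl)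
... | no u≢v = inj₂ (u≢v , edge-path u≢v (s≤s z≤n) 1∈uv , λ _ → arrival-positive)
  where
  1∈uv : 1 ∈ labels (completeAtOne _) u v
  1∈uv = subst (1 ∈_) (sym (offDiagonal-≢ u≢v)) (here refl)

FoEntry≡1⇒1∈labels : IsFoEntry G u v (fin 1) → 1 ∈ labels G u v
FoEntry≡1⇒1∈labels (inj₁ (_ , ()))
FoEntry≡1⇒1∈labels (inj₂ (_ , path , _)) = arrival≡1⇒1∈labels path

allOnes-realizer-labels-every-pair : FoEq G (allOnes n) → u ≢ v → 1 ∈ labels G u v
allOnes-realizer-labels-every-pair {G = G} {u = u} {v = v} Fo u≢v =
  FoEntry≡1⇒1∈labels (subst (IsFoEntry G u v) (offDiagonal-≢ u≢v) (Fo u v))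

sum-tabulate-mono-≤ : {f g : Fin n → ℕ} → (∀ i → f i ≤ g i) → sum (tabulate f) ≤ sum (tabulate g)
sum-tabulate-mono-≤ {n = 0} _ = z≤n
sum-tabulate-mono-≤ {n = suc _} f≤g =
  +-mono-≤ (f≤g zero) (sum-tabulate-mono-≤ (λ i → f≤g (suc i)))

positive⇒n≤sum-tabulate : {f : Fin n → ℕ} → (∀ i → 0 < f i) → n ≤ sum (tabulate f)
positive⇒n≤sum-tabulate {n = 0} _ = z≤n
positive⇒n≤sum-tabulate {n = suc _} 0<f =
  +-mono-≤ (0<f zero) (positive⇒n≤sum-tabulate (λ i → 0<f (suc i)))

[1+n]C2≡n+nC2 : ∀ n → suc n C 2 ≡ n + n C 2
[1+n]C2≡n+nC2 n = begin
  suc n C 2         ≡⟨ nCk+nC[k+1]≡[n+1]C[k+1] n 1 ⟨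
  n C 1 + n C 2     ≡⟨ cong (_+ n C 2) (nC1≡n n) ⟩
  n + n C 2         ∎
  where open ≡-Reasoning

nC2≤sum-above-diagonal : (r : Fin n → Fin n → ℕ) → (∀ {u v} → u <ᶠ v → 0 < r u v)
  → n C 2 ≤ sum (tabulate λ u → sum (tabulate (r u)))
nC2≤sum-above-diagonal {n = 0} _ _ = z≤n
nC2≤sum-above-diagonal {n = suc n} r 0<r = begin
  suc n C 2    ≡⟨ [1+n]C2≡n+nC2 n ⟩
  n + n C 2    ≤⟨ +-mono-≤ firstRow otherRows ⟩
  sum (tabulate (r zero)) + sum (tabulate λ u → sum (tabulate (r (suc u))))  ∎
  where
  open ≤-Reasoning
  firstRow : n ≤ sum (tabulate (r zero))
  firstRow = ≤-trans (positive⇒n≤sum-tabulate (λ _ → 0<r (s≤s z≤n))) (m≤n+m _ (r zero zero))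
  otherRows : n C 2 ≤ sum (tabulate λ u → sum (tabulate (r (suc u))))
  otherRows = ≤-trans (nC2≤sum-above-diagonal (λ u v → r (suc u) (suc v)) (λ u<v → 0<r (s≤s u<v)))
                      (sum-tabulate-mono-≤ (λ u → m≤n+m _ (r (suc u) zero)))

-- The summand of numLabels is local to its where-block; it is named here by unification.
numLabels-as-double-sum : (G : TemporalGraph n) → ∃ λ (entry : Fin n → Fin n → ℕ) →
  numLabels G ≡ sum (map (λ u → sum (map (entry u) (allFin n))) (allFin n))
numLabels-as-double-sum G = _ , refl

labelEntry : TemporalGraph n → Fin n → Fin n → ℕ
labelEntry G = proj₁ (numLabels-as-double-sum G)

labelEntry-above-diagonal : (G : TemporalGraph n) {u v : Fin n} → u <ᶠ v
  → labelEntry G u v ≡ length (labels G u v)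
labelEntry-above-diagonal G {u} {v} u<v with toℕ u <? toℕ v
... | yes _ = refl
... | no u≮v = ⊥-elim (u≮v u<v)

numLabels≡sum-tabulate : (G : TemporalGraph n)
  → numLabels G ≡ sum (tabulate λ u → sum (tabulate (labelEntry G u)))
numLabels≡sum-tabulate {n} G = begin
  numLabels G
    ≡⟨ proj₂ (numLabels-as-double-sum G) ⟩
  sum (map row (allFin n))
    ≡⟨ cong sum (map-tabulate id row) ⟩
  sum (tabulate row)
    ≡⟨ cong sum (tabulate-cong λ u → cong sum (map-tabulate id (labelEntry G u))) ⟩
  sum (tabulate λ u → sum (tabulate (labelEntry G u)))
    ∎
  where
  open ≡-Reasoning
  row : Fin n → ℕ
  row u = sum (map (labelEntry G u) (allFin n))

nC2≤numLabels : (G : TemporalGraph n) → (∀ {u v} → u <ᶠ v → 0 < length (labels G u v))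
  → n C 2 ≤ numLabels G
nC2≤numLabels G labelled = subst (_ ≤_) (sym (numLabels≡sum-tabulate G))
  (nC2≤sum-above-diagonal (labelEntry G) λ u<v →
    subst (0 <_) (sym (labelEntry-above-diagonal G u<v)) (labelled u<v))

n²≤4*nC2 : ∀ n → 2 ≤ n → n * n ≤ 4 * (n C 2)
n²≤4*nC2 1 (s≤s ())
n²≤4*nC2 2 _ = ≤-refl
n²≤4*nC2 (suc n@(suc (suc _))) _ = begin
  suc n * suc n         ≡⟨ square-suc n ⟩
  n * n + suc (n + n)   ≤⟨ +-mono-≤ (n²≤4*nC2 n (s≤s (s≤s z≤n))) 1+2n≤4n ⟩
  4 * (n C 2) + 4 * n   ≡⟨ *-distribˡ-+ 4 (n C 2) n ⟨
  4 * (n C 2 + n)       ≡⟨ cong (4 *_) (trans (+-comm (n C 2) n) (sym ([1+n]C2≡n+nC2 n))) ⟩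
  4 * (suc n C 2)       ∎
  where
  open ≤-Reasoning
  square-suc : ∀ m → suc m * suc m ≡ m * m + suc (m + m)
  square-suc = solve-∀
  four-times : ∀ m → 4 * m ≡ (m + m) + (m + m)
  four-times = solve-∀
  1+2n≤4n : suc (n + n) ≤ 4 * n
  1+2n≤4n = subst (suc (n + n) ≤_) (sym (four-times n))
                  (+-monoˡ-≤ (n + n) {1} {n + n} (s≤s z≤n))

proposition3p2 :
    Σ ((n : ℕ) → Matrix n) λ D →
      ((n : ℕ) → 1 ≤ n → IsDistanceMatrix (D n) × FoRealizable (D n))
      × ∃ λ (c : ℕ) → ∃ λ (n₀ : ℕ) → (n : ℕ) → n₀ ≤ n →
          (G : TemporalGraph n) → FoEq G (D n) → n * n ≤ c * numLabels G
proposition3p2 =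
  allOnes ,
  (λ n _ → allOnes-isDistanceMatrix , completeAtOne n , completeAtOne-realizes-allOnes) ,
  4 , 2 , λ n 2≤n G Fo →
    ≤-trans (n²≤4*nC2 n 2≤n)
      (*-monoʳ-≤ 4 (nC2≤numLabels G λ u<v →
        ∈-length (allOnes-realizer-labels-every-pair Fo (<⇒≢ u<v))))
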